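{- Let $A,B$ be reals. Then $B\geq_g A$ if and only if there is a Turing functional $\varphi$ such that: (1) for every generic oracle $(B)$ for $B$, $\varphi^{(B)}$ is a generic computation of $A$; and (2) for every real $C$ such that some real generically reduces to $C$ via $\varphi$, and for all partial oracles $(C)_0$, $(C)_1$ for $C$ with $\mathrm{dom}((C)_0)\subseteq\mathrm{dom}((C)_1)$ and $(C)_1\upharpoonright\mathrm{dom}((C)_0)=(C)_0$ (regarding partial oracles as partial functions $n\mapsto x$), we have $\mathrm{dom}(\varphi^{(C)_0})\subseteq\mathrm{dom}(\varphi^{(C)_1})$ and $\varphi^{(C)_1}\upharpoonright\mathrm{dom}(\varphi^{(C)_0})=\varphi^{(C)_0}$.
   Context: Reals are subsets of $\mathbb{N}$; $n=\{0,\dots,n-1\}$; a real $A$ is density-1 if $\lim_{n\to\infty}|A\cap n|/n=1$. A partial oracle for a real $C$ is a set $(C)$ of triples $\langle n,x,l\rangle$ (coded as naturals, usable as a Turing oracle) such that $\langle n,0,l\rangle\in(C)$ implies $n\notin C$ and $\langle n,1,l\rangle\in(C)$ implies $n\in C$; $\mathrm{dom}((C))=\{n:\exists x,l\ \langle n,x,l\rangle\in(C)\}$; viewed as a partial function it sends $n$ to the $x$ with $\langle n,x,l\rangle\in(C)$ for some $l$. A generic oracle for $C$ is a partial oracle for $C$ with density-1 domain. $\varphi^X$ is a generic computation of $D$ if $\mathrm{dom}(\varphi^X)$ is density-1, $\varphi^X$ has values in $\{0,1\}$, and agrees with $D$ on its domain. $C\geq_g D$ (equivalently, $D$ generically reduces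 to $C$) if there is a single Turing functional $\varphi$ such that for every generic oracle $(C)$ for $C$, $\varphi^{(C)}$ is a generic computation of $D$; in that case $D$ generically reduces to $C$ via $\varphi$. -}

module Defs where

open import Data.Nat using (ℕ; zero; suc; _+_; _*_; _∸_; _<_; _≤_; _/_)
open import Data.Bool using (Bool; true; false; if_then_else_)
open import Data.Fin using (Fin)
open import Data.Vec using (Vec; []; _∷_; lookup)
open import Data.List using (List; length)
open import Data.List.Relation.Unary.All using (All)
open import Data.List.Relation.Unary.Unique.Propositional using (Unique)
open import Data.Product using (Σ; ∃; _×_; _,_)
open import Data.Sum using (_⊎_)
open import Relation.Binary.PropositionalEquality using (_≡_)

-- Reals: subsets of ℕ, represented by characteristic functions.

Real : Set
Real = ℕ → Bool

-- Coding of pairs and triples (Cantor pairing, a bijection ℕ×ℕ → ℕ).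

pair : ℕ → ℕ → ℕ
pair a b = ((a + b) * suc (a + b)) / 2 + b

triple : ℕ → ℕ → ℕ → ℕ
triple n x l = pair n (pair x l)

-- Turing functionals: codes of oracle partial recursive functions
-- (Kleene's formalism with an oracle-query basic function).

data Code : ℕ → Set where
  zer  : ∀ {n} → Code n
  succ : Code 1
  proj : ∀ {n} → Fin n → Code n
  orac : Code 1
  comp : ∀ {m n} → Code m → (Fin m → Code n) → Code n
  prec : ∀ {n} → Code n → Code (suc (suc n)) → Code (suc n)
  mu   : ∀ {n} → Code (suc n) → Code n

data Eval (X : ℕ → Bool) : ∀ {n} → Code n → Vec ℕ n → ℕ → Set where
  ev-zer  : ∀ {n} {xs : Vec ℕ n} → Eval X zer xs 0
  ev-succ : ∀ {x} → Eval X succ (x ∷ []) (suc x)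
  ev-proj : ∀ {n} {xs : Vec ℕ n} (i : Fin n) → Eval X (proj i) xs (lookup xs i)
  ev-orac : ∀ {x} → Eval X orac (x ∷ []) (if X x then 1 else 0)
  ev-comp : ∀ {m n} {f : Code m} {gs : Fin m → Code n} {xs : Vec ℕ n} {y}
              (ys : Vec ℕ m) →
              (∀ i → Eval X (gs i) xs (lookup ys i)) →
              Eval X f ys y → Eval X (comp f gs) xs y
  ev-prec0 : ∀ {n} {g : Code n} {h : Code (suc (suc n))} {xs : Vec ℕ n} {y} →
              Eval X g xs y → Eval X (prec g h) (0 ∷ xs) y
  ev-precS : ∀ {n} {g : Code n} {h : Code (suc (suc n))} {xs : Vec ℕ n} {k z y} →
              Eval X (prec g h) (k ∷ xs) z →
              Eval X h (k ∷ z ∷ xs) y → Eval X (prec g h) (suc k ∷ xs) y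
  ev-mu   : ∀ {n} {f : Code (suc n)} {xs : Vec ℕ n} {y} →
              Eval X f (y ∷ xs) 0 →
              (∀ z → z < y → ∃ λ w → Eval X f (z ∷ xs) (suc w)) →
              Eval X (mu f) xs y

Functional : Set
Functional = Code 1

_^_⟨_⟩≡_ : Functional → (ℕ → Bool) → ℕ → ℕ → Set
φ ^ X ⟨ n ⟩≡ y = Eval X φ (n ∷ []) y

domF : Functional → (ℕ → Bool) → ℕ → Set
domF φ X n = ∃ λ y → φ ^ X ⟨ n ⟩≡ y

-- Density 1 (for an arbitrary, possibly undecidable, predicate P):
-- for every k, eventually P contains at least n - n/(k+1) elements below n,
-- witnessed by a duplicate-free list of such elements.

Density1 : (ℕ → Set) → Set
Density1 P = ∀ k → ∃ λ N → ∀ n → N ≤ n →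
  Σ (List ℕ) λ xs → Unique xs × All (λ m → m < n × P m) xs ×
                    suc k * (n ∸ length xs) ≤ n

IsPartialOracle : Real → (ℕ → Bool) → Set
IsPartialOracle C O = ∀ n x l → O (triple n x l) ≡ true →
  (x ≡ 0 × C n ≡ false) ⊎ (x ≡ 1 × C n ≡ true)

-- value relation of the partial oracle viewed as a partial function n ↦ x
oval : (ℕ → Bool) → ℕ → ℕ → Set
oval O n x = ∃ λ l → O (triple n x l) ≡ true

dom : (ℕ → Bool) → ℕ → Set
dom O n = ∃ λ x → oval O n x

GenericOracle : Real → (ℕ → Bool) → Set
GenericOracle C O = IsPartialOracle C O × Density1 (dom O)

GenericComputation : Functional → (ℕ → Bool) → Real → Set
GenericComputation φ X D =
  Density1 (domF φ X) ×
  (∀ n y → φ ^ X ⟨ n ⟩≡ y → (y ≡ 0 × D n ≡ false) ⊎ (y ≡ 1 × D n ≡ true))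

GenRedVia : Real → Real → Functional → Set
GenRedVia D C φ = ∀ O → GenericOracle C O → GenericComputation φ O D

_≥g_ : Real → Real → Set
C ≥g D = ∃ λ φ → GenRedVia D C φ

OracleExtends : (ℕ → Bool) → (ℕ → Bool) → Set
OracleExtends O₀ O₁ =
  (∀ n → dom O₀ n → dom O₁ n) ×
  (∀ n → dom O₀ n → ∀ x → (oval O₁ n x → oval O₀ n x) × (oval O₀ n x → oval O₁ n x))

FunctionalExtends : Functional → (ℕ → Bool) → (ℕ → Bool) → Set
FunctionalExtends φ O₀ O₁ =
  (∀ n → domF φ O₀ n → domF φ O₁ n) ×
  (∀ n → domF φ O₀ n → ∀ y →
     (φ ^ O₁ ⟨ n ⟩≡ y → φ ^ O₀ ⟨ n ⟩≡ y) × (φ ^ O₀ ⟨ n ⟩≡ y → φ ^ O₁ ⟨ n ⟩≡ y))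

module Submission where

-- The backward direction forgets the monotonicity clause.  For the forward
-- direction, given a reduction φ we build its monotonisation ψ = monotone φ.
-- On input n, ψ^X searches for a bound w and a finite snapshot s ≤ w -- a
-- finite set of oracle positions coded in binary -- such that every triple
-- ⟨m,x,l⟩ in s is justified by X (X contains some ⟨m,x,l'⟩ with l' ≤ w),
-- and φ run for w steps with oracle s halts on n; it outputs that value.
-- Justification only uses positive oracle information, so it survives the
-- passage from (C)₀ to an extension (C)₁; hence dom ψ^(C)₀ ⊆ dom ψ^(C)₁.
-- Values agree because, by the finite-use principle, every halting
-- computation on a partial oracle for C is also a computation on some
-- total (hence generic) oracle for C, so its value is forced by D.

open import Defs
open import Data.Nat using (ℕ; zero; suc; _+_; _*_; _∸_; _<_; _≤_; _/_; z≤n; s≤s; _⊔_; pred; _≟_)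
open import Data.Nat.Properties
open import Data.Nat.DivMod using (m*n/n≡m)
open import Data.Nat.Tactic.RingSolver using (solve-∀)
open import Data.Nat.ListAction using (sum)
open import Data.Bool using (Bool; true; false; if_then_else_)
open import Data.Fin using (Fin; zero; suc)
open import Data.Vec using (Vec; []; _∷_; lookup; tabulate)
open import Data.Vec.Properties using (tabulate∘lookup; tabulate-cong; lookup∘tabulate)
open import Data.List using (List; []; _∷_; _++_; upTo)
open import Data.List.Properties using (length-upTo)
open import Data.List.Membership.Propositional using (_∈_; _∉_)
open import Data.List.Membership.Propositional.Properties using (∈-++⁺ˡ; ∈-++⁺ʳ)
open import Data.List.Membership.DecPropositional _≟_ using (_∈?_)
open import Data.List.Relation.Unary.Any using (here; there)
import Data.List.Relation.Unary.All as All
open import Data.List.Relation.Unary.All.Properties using (all-upTo)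
open import Data.List.Relation.Unary.Unique.Propositional.Properties using (upTo⁺)
open import Data.Product using (∃; _×_; _,_; proj₁; proj₂)
open import Data.Sum using (_⊎_; inj₁; inj₂)
open import Data.Empty using (⊥-elim)
open import Data.Unit using (⊤; tt)
open import Relation.Nullary using (yes; no)
open import Relation.Binary.PropositionalEquality
open import Relation.Binary.Definitions using (tri<; tri≈; tri>)
open import Function.Bundles using (_⇔_; mk⇔)

vec-ext : ∀ {n} {ys ys' : Vec ℕ n} → (∀ i → lookup ys i ≡ lookup ys' i) → ys ≡ ys'
vec-ext {ys = ys} {ys'} p =
  trans (sym (tabulate∘lookup ys)) (trans (tabulate-cong p) (tabulate∘lookup ys'))

det : ∀ {X n} {c : Code n} {xs y y'} → Eval X c xs y → Eval X c xs y' → y ≡ y'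
det ev-zer ev-zer = refl
det ev-succ ev-succ = refl
det (ev-proj i) (ev-proj .i) = refl
det ev-orac ev-orac = refl
det (ev-comp ys gs f) (ev-comp ys' gs' f')
  with vec-ext {ys = ys} {ys'} (λ i → det (gs i) (gs' i))
... | refl = det f f'
det (ev-prec0 g) (ev-prec0 g') = det g g'
det (ev-precS p h) (ev-precS p' h') with det p p'
... | refl = det h h'
det (ev-mu {y = y} f lt) (ev-mu {y = y'} f' lt') with <-cmp y y'
... | tri≈ _ e _ = e
... | tri< y<y' _ _ = ⊥-elim (1+n≢0 (det (proj₂ (lt' y y<y')) f))
... | tri> _ _ y'<y = ⊥-elim (1+n≢0 (det (proj₂ (lt y' y'<y)) f'))

-- Instances: "depends on finitely many oracle positions"
-- and "holds from some point on".
module Intersections {A : Set} (Large : (A → Set) → Set)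
  (large-mono : ∀ {P Q : A → Set} → Large P → (∀ a → P a → Q a) → Large Q)
  (large-full : Large (λ _ → ⊤))
  (large-both : ∀ {P Q : A → Set} → Large P → Large Q → Large (λ a → P a × Q a)) where

  large-fin : ∀ {m} {P : Fin m → A → Set} → (∀ i → Large (P i)) → Large (λ a → ∀ i → P i a)
  large-fin {zero} h = large-mono large-full (λ _ _ ())
  large-fin {suc m} h = large-mono (large-both (h zero) (large-fin (λ i → h (suc i))))
    (λ { a (p , ps) zero → p ; a (p , ps) (suc i) → ps i })

  large-below : ∀ y {P : ℕ → A → Set} → (∀ z → z < y → Large (P z)) →
    Large (λ a → ∀ z → z < y → P z a)
  large-below zero h = large-mono large-full (λ _ _ _ ())
  large-below (suc y) {P} h =
    large-mono (large-both (h y ≤-refl) (large-below y (λ z z<y → h z (m≤n⇒m≤1+n z<y))))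
      (λ a (at-y , below) z z< → split (m≤n⇒m<n∨m≡n z<) at-y below)
    where
    split : ∀ {z a} → suc z < suc y ⊎ suc z ≡ suc y → P y a → (∀ z → z < y → P z a) → P z a
    split (inj₂ refl) at-y _ = at-y
    split {z} (inj₁ (s≤s z<y)) _ below = below z z<y

Agree : List ℕ → (ℕ → Bool) → (ℕ → Bool) → Set
Agree Q X Y = ∀ q → q ∈ Q → Y q ≡ X q

FiniteUse : (ℕ → Bool) → ((ℕ → Bool) → Set) → Set
FiniteUse X R = ∃ λ Q → ∀ Y → Agree Q X Y → R Y

use-both : ∀ {X R S} → FiniteUse X R → FiniteUse X S → FiniteUse X (λ Y → R Y × S Y)
use-both (Q , h) (Q' , h') =
  Q ++ Q' , λ Y ag → h Y (λ q m → ag q (∈-++⁺ˡ m)) , h' Y (λ q m → ag q (∈-++⁺ʳ Q m))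

module _ {X : ℕ → Bool} where
  open Intersections (FiniteUse X) (λ (Q , h) f → Q , λ Y ag → f Y (h Y ag)) ([] , λ _ _ → tt) use-both
    public renaming (large-fin to use-fin; large-below to use-below)

-- Finite use principle: a halting computation queries its oracle at only
-- finitely many positions, so it also halts, with the same value, relative
-- to any oracle agreeing with the original one there.
finite-use : ∀ {X n} {c : Code n} {xs y} → Eval X c xs y → FiniteUse X (λ Y → Eval Y c xs y)
finite-use ev-zer = [] , λ _ _ → ev-zer
finite-use ev-succ = [] , λ _ _ → ev-succ
finite-use (ev-proj i) = [] , λ _ _ → ev-proj i
finite-use (ev-orac {x}) =
  x ∷ [] , λ Y ag → subst (λ b → Eval Y orac (x ∷ []) (if b then 1 else 0)) (ag x (here refl)) ev-orac
finite-use {c = comp f gs} {xs} (ev-comp ys es ef)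
  with use-both (use-fin {P = λ i Y → Eval Y (gs i) xs (lookup ys i)} (λ i → finite-use (es i)))
                (finite-use ef)
... | (Q , h) = Q , λ Y ag → ev-comp ys (proj₁ (h Y ag)) (proj₂ (h Y ag))
finite-use (ev-prec0 e) with finite-use e
... | (Q , h) = Q , λ Y ag → ev-prec0 (h Y ag)
finite-use (ev-precS e₁ e₂) with use-both (finite-use e₁) (finite-use e₂)
... | (Q , h) = Q , λ Y ag → ev-precS (proj₁ (h Y ag)) (proj₂ (h Y ag))
finite-use {c = mu f} {xs} {y} (ev-mu e₀ below)
  with use-both (finite-use e₀)
         (use-below y {P = λ z Y → ∃ λ w → Eval Y f (z ∷ xs) (suc w)}
            (λ z z<y → let (w , ew) = below z z<y ; (Q , h) = finite-use ew
                       in Q , λ Y ag → w , h Y ag))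
... | (Q , h) = Q , λ Y ag → ev-mu (proj₁ (h Y ag)) (proj₂ (h Y ag))

-- A code c computes the total function f relative to the oracle X.  Below,
-- fooK is always a code and fooC : Computes X fooK spec states what it computes.
Computes : (ℕ → Bool) → ∀ {n} → Code n → (Vec ℕ n → ℕ) → Set
Computes X c f = ∀ xs → Eval X c xs (f xs)

computes-ext : ∀ {X n} {c : Code n} {f g : Vec ℕ n → ℕ} →
  Computes X c f → (∀ xs → f xs ≡ g xs) → Computes X c g
computes-ext {X} {c = c} cf e xs = subst (Eval X c xs) (e xs) (cf xs)

zerC : ∀ {X n} → Computes X (zer {n}) (λ _ → 0)
zerC xs = ev-zer

projC : ∀ {X n} (i : Fin n) → Computes X (proj i) (λ xs → lookup xs i)
projC i xs = ev-proj i

succC : ∀ {X} → Computes X succ (λ { (x ∷ []) → suc x })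
succC (x ∷ []) = ev-succ

oracC : ∀ {X} → Computes X orac (λ { (x ∷ []) → if X x then 1 else 0 })
oracC (x ∷ []) = ev-orac

compC : ∀ {X m n} {f : Code m} {gs : Fin m → Code n} {F : Vec ℕ m → ℕ} {G : Fin m → Vec ℕ n → ℕ} →
  Computes X f F → (∀ i → Computes X (gs i) (G i)) →
  Computes X (comp f gs) (λ xs → F (tabulate (λ i → G i xs)))
compC {X} {gs = gs} {G = G} cf cg xs = ev-comp (tabulate (λ i → G i xs))
  (λ i → subst (Eval X (gs i) xs) (sym (lookup∘tabulate (λ i → G i xs) i)) (cg i xs)) (cf _)

precC : ∀ {X n} {g : Code n} {h : Code (suc (suc n))} {G : Vec ℕ n → ℕ}
  {H : Vec ℕ (suc (suc n)) → ℕ} {F : Vec ℕ (suc n) → ℕ} →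
  Computes X g G → Computes X h H →
  (∀ xs → G xs ≡ F (0 ∷ xs)) → (∀ k xs → H (k ∷ F (k ∷ xs) ∷ xs) ≡ F (suc k ∷ xs)) →
  Computes X (prec g h) F
precC {X} {g = g} cg ch base step (zero ∷ xs) = ev-prec0 (subst (Eval X g xs) (base xs) (cg xs))
precC {X} {h = h} {F = F} cg ch base step (suc k ∷ xs) =
  ev-precS (precC {F = F} cg ch base step (k ∷ xs))
           (subst (Eval X h (k ∷ F (k ∷ xs) ∷ xs)) (step k xs) (ch _))

c1 : ∀ {n} → Code 1 → Code n → Code n
c1 f g = comp f (λ { zero → g })
c2 : ∀ {n} → Code 2 → Code n → Code n → Code n
c2 f g h = comp f (λ { zero → g ; (suc zero) → h })
c3 : ∀ {n} → Code 3 → Code n → Code n → Code n → Code n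
c3 f g h k = comp f (λ { zero → g ; (suc zero) → h ; (suc (suc zero)) → k })

c1C : ∀ {X n} {f : Code 1} {g : Code n} {F : Vec ℕ 1 → ℕ} {G : Vec ℕ n → ℕ} →
  Computes X f F → Computes X g G → Computes X (c1 f g) (λ xs → F (G xs ∷ []))
c1C {G = G} cf cg = compC {G = λ { zero → G }} cf (λ { zero → cg })
c2C : ∀ {X n} {f : Code 2} {g h : Code n} {F : Vec ℕ 2 → ℕ} {G H : Vec ℕ n → ℕ} →
  Computes X f F → Computes X g G → Computes X h H →
  Computes X (c2 f g h) (λ xs → F (G xs ∷ H xs ∷ []))
c2C {G = G} {H} cf cg ch =
  compC {G = λ { zero → G ; (suc zero) → H }} cf (λ { zero → cg ; (suc zero) → ch })
c3C : ∀ {X n} {f : Code 3} {g h k : Code n} {F : Vec ℕ 3 → ℕ} {G H K : Vec ℕ n → ℕ} →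
  Computes X f F → Computes X g G → Computes X h H → Computes X k K →
  Computes X (c3 f g h k) (λ xs → F (G xs ∷ H xs ∷ K xs ∷ []))
c3C {G = G} {H} {K} cf cg ch ck =
  compC {G = λ { zero → G ; (suc zero) → H ; (suc (suc zero)) → K }} cf
        (λ { zero → cg ; (suc zero) → ch ; (suc (suc zero)) → ck })

-- Zero test; throughout, a natural number used as a truth value means "nonzero".
ifz : ℕ → ℕ → ℕ → ℕ
ifz zero b c = b
ifz (suc _) b c = c

ifz-nz : ∀ {a} b c → a ≢ 0 → ifz a b c ≡ c
ifz-nz {zero} b c ne = ⊥-elim (ne refl)
ifz-nz {suc a} b c ne = refl

nz-suc : ∀ {a} → a ≢ 0 → a ≡ suc (pred a)
nz-suc {zero} ne = ⊥-elim (ne refl)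
nz-suc {suc a} ne = refl

condK : Code 3
condK = prec (proj zero) (proj (suc (suc (suc zero))))
condC : ∀ {X} → Computes X condK (λ { (a ∷ b ∷ c ∷ []) → ifz a b c })
condC = precC (projC zero) (projC (suc (suc (suc zero))))
  (λ { (b ∷ c ∷ []) → refl }) (λ { k (b ∷ c ∷ []) → refl })

cnd : ∀ {n} → Code n → Code n → Code n → Code n
cnd = c3 condK

cndC : ∀ {X n} {g h k : Code n} {G H K : Vec ℕ n → ℕ} →
  Computes X g G → Computes X h H → Computes X k K →
  Computes X (cnd g h k) (λ xs → ifz (G xs) (H xs) (K xs))
cndC = c3C condC

oneK : ∀ {n} → Code n
oneK = c1 succ zer
oneC : ∀ {X n} → Computes X (oneK {n}) (λ _ → 1)
oneC = c1C succC zerC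

predK : Code 1
predK = prec zer (proj zero)
predC : ∀ {X} → Computes X predK (λ { (x ∷ []) → pred x })
predC = precC zerC (projC zero) (λ { [] → refl }) (λ { k [] → refl })

addK : Code 2
addK = prec (proj zero) (c1 succ (proj (suc zero)))
addC : ∀ {X} → Computes X addK (λ { (a ∷ b ∷ []) → a + b })
addC = precC (projC zero) (c1C succC (projC (suc zero)))
  (λ { (b ∷ []) → refl }) (λ { k (b ∷ []) → refl })

parity : ℕ → ℕ
parity zero = 0
parity (suc k) = ifz (parity k) 1 0

half : ℕ → ℕ
half zero = 0
half (suc k) = half k + parity k

halves : ℕ → ℕ → ℕ
halves zero s = s
halves (suc q) s = half (halves q s)

bit : ℕ → ℕ → ℕ
bit s q = parity (halves q s)

parityK : Code 1
parityK = prec zer (cnd (proj (suc zero)) oneK zer)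
parityC : ∀ {X} → Computes X parityK (λ { (x ∷ []) → parity x })
parityC = precC zerC (cndC (projC (suc zero)) oneC zerC) (λ { [] → refl }) (λ { k [] → refl })

halfK : Code 1
halfK = prec zer (c2 addK (proj (suc zero)) (c1 parityK (proj zero)))
halfC : ∀ {X} → Computes X halfK (λ { (x ∷ []) → half x })
halfC = precC zerC (c2C addC (projC (suc zero)) (c1C parityC (projC zero)))
  (λ { [] → refl }) (λ { k [] → refl })

halvesK : Code 2
halvesK = prec (proj zero) (c1 halfK (proj (suc zero)))
halvesC : ∀ {X} → Computes X halvesK (λ { (q ∷ s ∷ []) → halves q s })
halvesC = precC (projC zero) (c1C halfC (projC (suc zero)))
  (λ { (s ∷ []) → refl }) (λ { k (s ∷ []) → refl })

bitK : Code 2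
bitK = c1 parityK halvesK
bitC : ∀ {X} → Computes X bitK (λ { (q ∷ s ∷ []) → bit s q })
bitC = computes-ext (c1C parityC halvesC) (λ { (q ∷ s ∷ []) → refl })

parity-bit : ∀ n → parity n ≡ 0 ⊎ parity n ≡ 1
parity-bit zero = inj₁ refl
parity-bit (suc n) with parity n | parity-bit n
... | .0 | inj₁ refl = inj₂ refl
... | .1 | inj₂ refl = inj₁ refl

parity-ss : ∀ n → parity (suc (suc n)) ≡ parity n
parity-ss n with parity n | parity-bit n
... | .0 | inj₁ refl = refl
... | .1 | inj₂ refl = refl

half-ss : ∀ n → half (suc (suc n)) ≡ suc (half n)
half-ss n with parity n | parity-bit n
... | .0 | inj₁ refl = trans (cong (_+ 1) (+-identityʳ (half n))) (+-comm (half n) 1)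
... | .1 | inj₂ refl = trans (+-identityʳ (half n + 1)) (+-comm (half n) 1)

half≤pred : ∀ n → half n ≤ pred n
half≤pred zero = z≤n
half≤pred (suc zero) = z≤n
half≤pred (suc (suc n)) rewrite half-ss n = s≤s (≤-trans (half≤pred n) (≤pred⇒≤ ≤-refl))

halves≤ : ∀ q s → halves q s ≤ s ∸ q
halves≤ zero s = ≤-refl
halves≤ (suc q) s = begin
  half (halves q s) ≤⟨ half≤pred (halves q s) ⟩
  pred (halves q s) ≤⟨ pred-mono-≤ (halves≤ q s) ⟩
  pred (s ∸ q)      ≡⟨ pred[m∸n]≡m∸[1+n] s q ⟩
  s ∸ suc q         ∎
  where open ≤-Reasoning

bit-bound : ∀ s q → bit s q ≢ 0 → q < s
bit-bound s q ne with q <? s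
... | yes q<s = q<s
... | no q≮s = ⊥-elim (ne (cong parity (n≤0⇒n≡0
        (≤-trans (halves≤ q s) (≤-reflexive (m≤n⇒m∸n≡0 (≮⇒≥ q≮s)))))))

halves-shift : ∀ q s → halves (suc q) s ≡ halves q (half s)
halves-shift zero s = refl
halves-shift (suc q) s = cong half (halves-shift q s)

halves-zero : ∀ q → halves q 0 ≡ 0
halves-zero zero = refl
halves-zero (suc q) = cong half (halves-zero q)

b2n : Bool → ℕ
b2n true = 1
b2n false = 0

isNZ : ℕ → Bool
isNZ zero = false
isNZ (suc _) = true

isNZ-b2n : ∀ b → isNZ (b2n b) ≡ b
isNZ-b2n true = refl
isNZ-b2n false = refl

isNZ⇒≢0 : ∀ {a} → isNZ a ≡ true → a ≢ 0
isNZ⇒≢0 {suc a} _ ()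

≢0⇒isNZ : ∀ {a} → a ≢ 0 → isNZ a ≡ true
≢0⇒isNZ {zero} ne = ⊥-elim (ne refl)
≢0⇒isNZ {suc a} ne = refl

-- encode N f: the number whose binary digits are f 0, …, f (N - 1).
encode : ℕ → (ℕ → Bool) → ℕ
encode zero f = 0
encode (suc N) f = b2n (f 0) + (encode N (λ q → f (suc q)) + encode N (λ q → f (suc q)))

digit-suc : ∀ b m → b + (suc m + suc m) ≡ suc (suc (b + (m + m)))
digit-suc = solve-∀

parity-digit : ∀ b m → parity (b2n b + (m + m)) ≡ b2n b
parity-digit false zero = refl
parity-digit true zero = refl
parity-digit b (suc m) rewrite digit-suc (b2n b) m = trans (parity-ss (b2n b + (m + m))) (parity-digit b m)

half-digit : ∀ b m → half (b2n b + (m + m)) ≡ m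
half-digit false zero = refl
half-digit true zero = refl
half-digit b (suc m) rewrite digit-suc (b2n b) m = trans (half-ss (b2n b + (m + m))) (cong suc (half-digit b m))

halves-encode : ∀ N f q →
  halves (suc q) (encode (suc N) f) ≡ halves q (encode N (λ q → f (suc q)))
halves-encode N f q =
  trans (halves-shift q _) (cong (halves q) (half-digit (f 0) (encode N (λ q → f (suc q)))))

bit-encode-out : ∀ N f q → N ≤ q → bit (encode N f) q ≡ 0
bit-encode-out zero f q _ = cong parity (halves-zero q)
bit-encode-out (suc N) f (suc q) (s≤s N≤q) =
  trans (cong parity (halves-encode N f q)) (bit-encode-out N (λ q → f (suc q)) q N≤q)

bit-encode-in : ∀ N f q → q < N → bit (encode N f) q ≡ b2n (f q)
bit-encode-in (suc N) f zero _ = parity-digit (f 0) (encode N (λ q → f (suc q)))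
bit-encode-in (suc N) f (suc q) (s≤s q<N) =
  trans (cong parity (halves-encode N f q)) (bit-encode-in N (λ q → f (suc q)) q q<N)

-- The finite oracle with snapshot s: it answers yes exactly at the nonzero digits of s.
snapshot : ℕ → ℕ → Bool
snapshot s q = isNZ (bit s q)

snapshot-value : ∀ s q → (if snapshot s q then 1 else 0) ≡ bit s q
snapshot-value s q with bit s q | parity-bit (halves q s)
... | .0 | inj₁ refl = refl
... | .1 | inj₂ refl = refl

encode-agree : ∀ N X q → q < N → snapshot (encode N X) q ≡ X q
encode-agree N X q q<N = trans (cong isNZ (bit-encode-in N X q q<N)) (isNZ-b2n (X q))

encode-sub : ∀ N X q → bit (encode N X) q ≢ 0 → X q ≡ true
encode-sub N X q nb with q <? N
... | yes q<N = trans (sym (encode-agree N X q q<N)) (≢0⇒isNZ nb)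
... | no q≮N = ⊥-elim (nb (bit-encode-out N X q (≮⇒≥ q≮N)))

tri : ℕ → ℕ
tri zero = 0
tri (suc k) = tri k + suc k

-- pair a b = tri (a + b) + b, since the k-th triangular number is k(k+1)/2.
tri-double : ∀ k → k * suc k ≡ tri k * 2
tri-double zero = refl
tri-double (suc k) = begin
  suc k * suc (suc k)      ≡⟨ expand k ⟩
  k * suc k + suc k * 2    ≡⟨ cong (_+ suc k * 2) (tri-double k) ⟩
  tri k * 2 + suc k * 2    ≡⟨ sym (*-distribʳ-+ 2 (tri k) (suc k)) ⟩
  (tri k + suc k) * 2      ∎
  where
  open ≡-Reasoning
  expand : ∀ k → suc k * suc (suc k) ≡ k * suc k + suc k * 2
  expand = solve-∀

pair≡ : ∀ a b → pair a b ≡ tri (a + b) + b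
pair≡ a b = cong (_+ b) (trans (cong (_/ 2) (tri-double (a + b))) (m*n/n≡m (tri (a + b)) 2))

triK : Code 1
triK = prec zer (c2 addK (proj (suc zero)) (c1 succ (proj zero)))
triC : ∀ {X} → Computes X triK (λ { (x ∷ []) → tri x })
triC = precC zerC (c2C addC (projC (suc zero)) (c1C succC (projC zero)))
  (λ { [] → refl }) (λ { k [] → refl })

pairK : Code 2
pairK = c2 addK (c1 triK addK) (proj (suc zero))
pairC : ∀ {X} → Computes X pairK (λ { (a ∷ b ∷ []) → pair a b })
pairC = computes-ext (c2C addC (c1C triC addC) (projC (suc zero)))
  (λ { (a ∷ b ∷ []) → sym (pair≡ a b) })

tripleK : Code 3
tripleK = c2 pairK (proj zero) (c2 pairK (proj (suc zero)) (proj (suc (suc zero))))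
tripleC : ∀ {X} → Computes X tripleK (λ { (a ∷ b ∷ c ∷ []) → triple a b c })
tripleC = computes-ext (c2C pairC (projC zero) (c2C pairC (projC (suc zero)) (projC (suc (suc zero)))))
  (λ { (a ∷ b ∷ c ∷ []) → refl })

tri-mono : ∀ {j k} → j ≤ k → tri j ≤ tri k
tri-mono {j} {zero} z≤n = z≤n
tri-mono {zero} {suc k} _ = z≤n
tri-mono {suc j} {suc k} (s≤s p) = +-mono-≤ (tri-mono p) (s≤s p)

pair≥ˡ : ∀ a b → a ≤ pair a b
pair≥ˡ a b rewrite pair≡ a b = ≤-trans (≤-trans (m≤m+n a b) (tri≥ (a + b))) (m≤m+n _ b)
  where
  tri≥ : ∀ k → k ≤ tri k
  tri≥ zero = z≤n
  tri≥ (suc k) = m≤n+m (suc k) (tri k)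

pair≥ʳ : ∀ a b → b ≤ pair a b
pair≥ʳ a b rewrite pair≡ a b = m≤n+m b _

triple≥₁ : ∀ n x l → n ≤ triple n x l
triple≥₁ n x l = pair≥ˡ n _
triple≥₂ : ∀ n x l → x ≤ triple n x l
triple≥₂ n x l = ≤-trans (pair≥ˡ x l) (pair≥ʳ n _)
triple≥₃ : ∀ n x l → l ≤ triple n x l
triple≥₃ n x l = ≤-trans (pair≥ʳ x l) (pair≥ʳ n _)

pair-diagonal : ∀ a b a' b' → a + b < a' + b' → pair a b < pair a' b'
pair-diagonal a b a' b' lt rewrite pair≡ a b | pair≡ a' b' = begin-strict
  tri (a + b) + b       ≤⟨ +-monoʳ-≤ (tri (a + b)) (m≤n+m b a) ⟩
  tri (a + b) + (a + b) <⟨ +-monoʳ-< (tri (a + b)) (n<1+n (a + b)) ⟩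
  tri (suc (a + b))     ≤⟨ tri-mono lt ⟩
  tri (a' + b')         ≤⟨ m≤m+n _ b' ⟩
  tri (a' + b') + b'    ∎
  where open ≤-Reasoning

pair-injective : ∀ {a b a' b'} → pair a b ≡ pair a' b' → a ≡ a' × b ≡ b'
pair-injective {a} {b} {a'} {b'} e with <-cmp (a + b) (a' + b')
... | tri< lt _ _ = ⊥-elim (<-irrefl e (pair-diagonal a b a' b' lt))
... | tri> _ _ gt = ⊥-elim (<-irrefl (sym e) (pair-diagonal a' b' a b gt))
... | tri≈ _ s _ = a≡a' , b≡b'
  where
  b≡b' : b ≡ b'
  b≡b' = +-cancelˡ-≡ (tri (a + b)) b b'
    (trans (sym (pair≡ a b)) (trans e (trans (pair≡ a' b') (cong (λ v → tri v + b') (sym s)))))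
  a≡a' : a ≡ a'
  a≡a' = +-cancelʳ-≡ b a a' (trans s (cong (a' +_) (sym b≡b')))

triple-injective : ∀ {n x l n' x' l'} → triple n x l ≡ triple n' x' l' → n ≡ n' × x ≡ x'
triple-injective e with pair-injective e
... | (n≡n' , rest) = n≡n' , proj₁ (pair-injective rest)

all≤ : ℕ → (ℕ → ℕ) → ℕ
all≤ zero p = p 0
all≤ (suc k) p = ifz (all≤ k p) 0 (p (suc k))

any≤ : ℕ → (ℕ → ℕ) → ℕ
any≤ zero p = p 0
any≤ (suc k) p = ifz (any≤ k p) (p (suc k)) 1

all≤-elim : ∀ N p → all≤ N p ≢ 0 → ∀ k → k ≤ N → p k ≢ 0
all≤-elim zero p h .0 z≤n = h
all≤-elim (suc N) p h k k≤ with all≤ N p in eq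
... | zero = ⊥-elim (h refl)
... | suc _ with m≤n⇒m<n∨m≡n k≤
...   | inj₂ refl = h
...   | inj₁ (s≤s k≤N) = all≤-elim N p (λ e → 1+n≢0 (trans (sym eq) e)) k k≤N

all≤-intro : ∀ N p → (∀ k → k ≤ N → p k ≢ 0) → all≤ N p ≢ 0
all≤-intro zero p h = h 0 z≤n
all≤-intro (suc N) p h with all≤ N p in eq
... | zero = ⊥-elim (all≤-intro N p (λ k k≤ → h k (m≤n⇒m≤1+n k≤)) eq)
... | suc _ = h (suc N) ≤-refl

any≤-elim : ∀ N p → any≤ N p ≢ 0 → ∃ λ k → k ≤ N × p k ≢ 0
any≤-elim zero p h = 0 , z≤n , h
any≤-elim (suc N) p h with any≤ N p in eq
... | zero = suc N , ≤-refl , h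
... | suc _ with any≤-elim N p (λ e → 1+n≢0 (trans (sym eq) e))
...   | (k , k≤ , pk) = k , m≤n⇒m≤1+n k≤ , pk

any≤-intro : ∀ N p k → k ≤ N → p k ≢ 0 → any≤ N p ≢ 0
any≤-intro zero p .0 z≤n h = h
any≤-intro (suc N) p k k≤ h with any≤ N p in eq
... | suc _ = λ ()
... | zero with m≤n⇒m<n∨m≡n k≤
...   | inj₂ refl = h
...   | inj₁ (s≤s k≤N) = ⊥-elim (any≤-intro N p k k≤N h eq)

atZero : ∀ {n} → Code (suc n) → Code n
atZero c = comp c (λ { zero → zer ; (suc i) → proj i })
atSuc : ∀ {n} → Code (suc n) → Code (suc (suc n))
atSuc c = comp c (λ { zero → c1 succ (proj zero) ; (suc i) → proj (suc (suc i)) })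

atZeroC : ∀ {X n} {c : Code (suc n)} {P : Vec ℕ (suc n) → ℕ} → Computes X c P →
  Computes X (atZero c) (λ rest → P (0 ∷ rest))
atZeroC {P = P} cp = computes-ext
  (compC {G = λ { zero → λ _ → 0 ; (suc i) → λ xs → lookup xs i }} cp
         (λ { zero → zerC ; (suc i) → projC i }))
  (λ xs → cong (λ v → P (0 ∷ v)) (vec-ext (lookup∘tabulate _)))

atSucC : ∀ {X n} {c : Code (suc n)} {P : Vec ℕ (suc n) → ℕ} → Computes X c P →
  Computes X (atSuc c) (λ { (k ∷ z ∷ rest) → P (suc k ∷ rest) })
atSucC {P = P} cp = computes-ext
  (compC {G = λ { zero → λ xs → suc (lookup xs zero) ; (suc i) → λ xs → lookup xs (suc (suc i)) }} cp
         (λ { zero → c1C succC (projC zero) ; (suc i) → projC (suc (suc i)) }))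
  (λ { (k ∷ z ∷ rest) → cong (λ v → P (suc k ∷ v)) (vec-ext (lookup∘tabulate _)) })

allK : ∀ {n} → Code (suc n) → Code (suc n)
allK c = prec (atZero c) (cnd (proj (suc zero)) zer (atSuc c))
allC : ∀ {X n} {c : Code (suc n)} {P : Vec ℕ (suc n) → ℕ} → Computes X c P →
  Computes X (allK c) (λ { (N ∷ rest) → all≤ N (λ k → P (k ∷ rest)) })
allC cp = precC (atZeroC cp) (cndC (projC (suc zero)) zerC (atSucC cp))
  (λ _ → refl) (λ _ _ → refl)

anyK : ∀ {n} → Code (suc n) → Code (suc n)
anyK c = prec (atZero c) (cnd (proj (suc zero)) (atSuc c) oneK)
anyC : ∀ {X n} {c : Code (suc n)} {P : Vec ℕ (suc n) → ℕ} → Computes X c P →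
  Computes X (anyK c) (λ { (N ∷ rest) → any≤ N (λ k → P (k ∷ rest)) })
anyC cp = precC (atZeroC cp) (cndC (projC (suc zero)) (atSucC cp) oneC)
  (λ _ → refl) (λ _ _ → refl)

-- Step-bounded simulation.  run c t s xs simulates c on xs relative to the
-- finite oracle snapshot s, cutting every unbounded search off at t; the
-- result is 0 if no value was found and suc y if the value y was found.

allDefined : ∀ {m} → Vec ℕ m → ℕ
allDefined [] = 1
allDefined (v ∷ vs) = ifz v 0 (allDefined vs)

runPrec : ℕ → ℕ → (ℕ → ℕ → ℕ) → ℕ
runPrec zero b st = b
runPrec (suc k) b st = ifz (runPrec k b st) 0 (st k (pred (runPrec k b st)))

-- State of a simulated μ-search after examining candidate k, given the
-- simulated value v of the searched function at k: 0 = keep searching,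
-- 1 = stuck (undefined), suc (suc k) = found k.
searchStep : ℕ → ℕ → ℕ
searchStep k v = ifz v 1 (ifz (pred v) (suc (suc k)) 0)

search : ℕ → (ℕ → ℕ) → ℕ
search zero fv = 0
search (suc k) fv = ifz (search k fv) (searchStep k (fv k)) (search k fv)

searchResult : ℕ → ℕ
searchResult r = ifz r 0 (ifz (pred r) 0 (pred r))

run : ∀ {n} → Code n → ℕ → ℕ → Vec ℕ n → ℕ
run zer t s xs = 1
run succ t s (x ∷ []) = suc (suc x)
run (proj i) t s xs = suc (lookup xs i)
run orac t s (x ∷ []) = suc (bit s x)
run (comp f gs) t s xs =
  ifz (allDefined (tabulate (λ i → run (gs i) t s xs))) 0
      (run f t s (tabulate (λ i → pred (run (gs i) t s xs))))
run (prec g h) t s (k ∷ xs) = runPrec k (run g t s xs) (λ k' z → run h t s (k' ∷ z ∷ xs))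
run (mu f) t s xs = searchResult (search t (λ k → run f t s (k ∷ xs)))

runSpec : ∀ {n} → Code n → Vec ℕ (suc (suc n)) → ℕ
runSpec c (t ∷ s ∷ xs) = run c t s xs

allDefinedK : ∀ {m k} → (Fin m → Code k) → Code k
allDefinedK {zero} cs = oneK
allDefinedK {suc m} cs = cnd (cs zero) zer (allDefinedK (λ i → cs (suc i)))

allDefinedC : ∀ {X m k} (cs : Fin m → Code k) {G : Fin m → Vec ℕ k → ℕ} →
  (∀ i → Computes X (cs i) (G i)) →
  Computes X (allDefinedK cs) (λ xs → allDefined (tabulate (λ i → G i xs)))
allDefinedC {m = zero} cs h = oneC
allDefinedC {m = suc m} cs h = cndC (h zero) zerC (allDefinedC (λ i → cs (suc i)) (λ i → h (suc i)))

searchStepK : Code 2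
searchStepK = cnd (proj (suc zero)) oneK
  (cnd (c1 predK (proj (suc zero))) (c1 succ (c1 succ (proj zero))) zer)
searchStepC : ∀ {X} → Computes X searchStepK (λ { (k ∷ v ∷ []) → searchStep k v })
searchStepC = computes-ext
  (cndC (projC (suc zero)) oneC (cndC (c1C predC (projC (suc zero))) (c1C succC (c1C succC (projC zero))) zerC))
  (λ { (k ∷ v ∷ []) → refl })

searchResultK : Code 1
searchResultK = cnd (proj zero) zer (cnd (c1 predK (proj zero)) zer (c1 predK (proj zero)))
searchResultC : ∀ {X} → Computes X searchResultK (λ { (r ∷ []) → searchResult r })
searchResultC = computes-ext
  (cndC (projC zero) zerC (cndC (c1C predC (projC zero)) zerC (c1C predC (projC zero))))
  (λ { (r ∷ []) → refl })

-- runK c is a code computing runSpec c (with any oracle: it only consults s).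
runK : ∀ {n} → Code n → Code (suc (suc n))
runK zer = oneK
runK succ = c1 succ (c1 succ (proj (suc (suc zero))))
runK (proj i) = c1 succ (proj (suc (suc i)))
runK orac = c1 succ (c2 bitK (proj (suc (suc zero))) (proj (suc zero)))
runK (comp f gs) = cnd (allDefinedK (λ i → runK (gs i))) zer
  (comp (runK f) (λ { zero → proj zero ; (suc zero) → proj (suc zero)
                    ; (suc (suc i)) → c1 predK (runK (gs i)) }))
runK (prec g h) = comp (prec (runK g)
    (cnd (proj (suc zero)) zer
      (comp (runK h) (λ { zero → proj (suc (suc zero)) ; (suc zero) → proj (suc (suc (suc zero)))
                        ; (suc (suc zero)) → proj zero ; (suc (suc (suc zero))) → c1 predK (proj (suc zero))
                        ; (suc (suc (suc (suc i)))) → proj (suc (suc (suc (suc i)))) }))))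
  (λ { zero → proj (suc (suc zero)) ; (suc zero) → proj zero ; (suc (suc zero)) → proj (suc zero)
     ; (suc (suc (suc i))) → proj (suc (suc (suc i))) })
runK (mu f) = c1 searchResultK (comp (prec zer
    (cnd (proj (suc zero))
      (c2 searchStepK (proj zero)
        (comp (runK f) (λ { zero → proj (suc (suc zero)) ; (suc zero) → proj (suc (suc (suc zero)))
                          ; (suc (suc zero)) → proj zero
                          ; (suc (suc (suc i))) → proj (suc (suc (suc (suc i)))) })))
      (proj (suc zero))))
  (λ { zero → proj zero ; (suc i) → proj i }))

runC : ∀ {X n} (c : Code n) → Computes X (runK c) (runSpec c)
runC zer = computes-ext oneC (λ { (t ∷ s ∷ xs) → refl })
runC succ = computes-ext (c1C succC (c1C succC (projC (suc (suc zero))))) (λ { (t ∷ s ∷ x ∷ []) → refl })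
runC (proj i) = computes-ext (c1C succC (projC (suc (suc i)))) (λ { (t ∷ s ∷ xs) → refl })
runC orac = computes-ext (c1C succC (c2C bitC (projC (suc (suc zero))) (projC (suc zero))))
  (λ { (t ∷ s ∷ x ∷ []) → refl })
runC (comp f gs) = computes-ext
  (cndC (allDefinedC (λ i → runK (gs i)) (λ i → runC (gs i))) zerC
    (compC {G = λ { zero → λ xs → lookup xs zero ; (suc zero) → λ xs → lookup xs (suc zero)
                  ; (suc (suc i)) → λ xs → pred (runSpec (gs i) xs) }}
       (runC f) (λ { zero → projC zero ; (suc zero) → projC (suc zero)
                   ; (suc (suc i)) → c1C predC (runC (gs i)) })))
  (λ { (t ∷ s ∷ xs) → refl })
runC (prec g h) = computes-ext
  (compC {G = λ { zero → λ xs → lookup xs (suc (suc zero)) ; (suc zero) → λ xs → lookup xs zero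
                ; (suc (suc zero)) → λ xs → lookup xs (suc zero)
                ; (suc (suc (suc i))) → λ xs → lookup xs (suc (suc (suc i))) }}
     (precC {F = λ { (k ∷ t ∷ s ∷ xs) → run (prec g h) t s (k ∷ xs) }} (runC g)
       (cndC (projC (suc zero)) zerC
         (compC {G = λ { zero → λ xs → lookup xs (suc (suc zero))
                       ; (suc zero) → λ xs → lookup xs (suc (suc (suc zero)))
                       ; (suc (suc zero)) → λ xs → lookup xs zero
                       ; (suc (suc (suc zero))) → λ xs → pred (lookup xs (suc zero))
                       ; (suc (suc (suc (suc i)))) → λ xs → lookup xs (suc (suc (suc (suc i)))) }}
            (runC h) (λ { zero → projC (suc (suc zero)) ; (suc zero) → projC (suc (suc (suc zero)))
                        ; (suc (suc zero)) → projC zero ; (suc (suc (suc zero))) → c1C predC (projC (suc zero))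
                        ; (suc (suc (suc (suc i)))) → projC (suc (suc (suc (suc i)))) })))
       (λ { (t ∷ s ∷ xs) → refl })
       (λ { k (t ∷ s ∷ xs) → let z = run (prec g h) t s (k ∷ xs) in
              cong (λ v → ifz z 0 (run h t s (k ∷ pred z ∷ v))) (tabulate∘lookup xs) }))
     (λ { zero → projC (suc (suc zero)) ; (suc zero) → projC zero ; (suc (suc zero)) → projC (suc zero)
        ; (suc (suc (suc i))) → projC (suc (suc (suc i))) }))
  (λ { (t ∷ s ∷ k ∷ xs) → cong (λ v → run (prec g h) t s (k ∷ v)) (tabulate∘lookup xs) })
runC (mu f) = computes-ext
  (c1C searchResultC (compC {G = λ { zero → λ xs → lookup xs zero ; (suc i) → λ xs → lookup xs i }}
    (precC {F = λ { (k ∷ t ∷ s ∷ xs) → search k (λ k' → run f t s (k' ∷ xs)) }} zerC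
      (cndC (projC (suc zero))
        (c2C searchStepC (projC zero)
          (compC {G = λ { zero → λ xs → lookup xs (suc (suc zero))
                        ; (suc zero) → λ xs → lookup xs (suc (suc (suc zero)))
                        ; (suc (suc zero)) → λ xs → lookup xs zero
                        ; (suc (suc (suc i))) → λ xs → lookup xs (suc (suc (suc (suc i)))) }}
             (runC f) (λ { zero → projC (suc (suc zero)) ; (suc zero) → projC (suc (suc (suc zero)))
                         ; (suc (suc zero)) → projC zero
                         ; (suc (suc (suc i))) → projC (suc (suc (suc (suc i)))) })))
        (projC (suc zero)))
      (λ { (t ∷ s ∷ xs) → refl })
      (λ { k (t ∷ s ∷ xs) → let z = search k (λ k' → run f t s (k' ∷ xs)) in
             cong (λ v → ifz z (searchStep k (run f t s (k ∷ v))) z) (tabulate∘lookup xs) }))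
    (λ { zero → projC zero ; (suc i) → projC i })))
  (λ { (t ∷ s ∷ xs) → cong (λ v → searchResult (search t (λ k → run f t s (k ∷ v)))) (tabulate∘lookup xs) })

allDefined-elim : ∀ {m} (h : Fin m → ℕ) → allDefined (tabulate h) ≢ 0 → ∀ i → h i ≢ 0
allDefined-elim {suc m} h ne i with h zero in eq
allDefined-elim h ne zero | zero = λ _ → ne refl
allDefined-elim h ne zero | suc _ = λ e → 1+n≢0 (trans (sym eq) e)
allDefined-elim h ne (suc i) | zero = ⊥-elim (ne refl)
allDefined-elim h ne (suc i) | suc _ = allDefined-elim (λ i → h (suc i)) ne i

allDefined-intro : ∀ {m} (h : Fin m → ℕ) → (∀ i → h i ≢ 0) → allDefined (tabulate h) ≢ 0
allDefined-intro {zero} h _ ()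
allDefined-intro {suc m} h hh with h zero in eq
... | zero = ⊥-elim (hh zero eq)
... | suc _ = allDefined-intro (λ i → h (suc i)) (λ i → hh (suc i))

search-running : ∀ k fv → search k fv ≡ 0 → ∀ z → z < k → ∃ λ w → fv z ≡ suc (suc w)
search-running (suc k) fv e z z< with search k fv in eq
... | suc _ = ⊥-elim (1+n≢0 e)
... | zero with fv k in eqf
...   | zero = ⊥-elim (1+n≢0 e)
...   | suc zero = ⊥-elim (1+n≢0 e)
...   | suc (suc w) with m≤n⇒m<n∨m≡n z<
...     | inj₂ refl = w , eqf
...     | inj₁ (s≤s z<k) = search-running k fv eq z z<k

search-found : ∀ k fv z → search k fv ≡ suc (suc z) →
  fv z ≡ 1 × (∀ z' → z' < z → ∃ λ w → fv z' ≡ suc (suc w))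
search-found (suc k) fv z e with search k fv in eq
... | suc r = search-found k fv z (trans eq e)
... | zero with fv k in eqf
...   | zero = ⊥-elim (1+n≢0 (suc-injective (sym e)))
...   | suc zero with e
...     | refl = eqf , search-running k fv eq
search-found (suc k) fv z () | zero | suc (suc w)

search-before : ∀ k fv y → k ≤ y → (∀ z → z < y → ∃ λ w → fv z ≡ suc (suc w)) → search k fv ≡ 0
search-before zero fv y _ _ = refl
search-before (suc k) fv y k≤ h rewrite search-before k fv y (≤-trans (n≤1+n k) k≤) h
  with h k k≤
... | (w , e) rewrite e = refl

search-finds : ∀ k fv y → y < k → fv y ≡ 1 → (∀ z → z < y → ∃ λ w → fv z ≡ suc (suc w)) →
  search k fv ≡ suc (suc y)
search-finds (suc k) fv y y< e h with m≤n⇒m<n∨m≡n y<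
... | inj₂ refl rewrite search-before k fv k ≤-refl h | e = refl
... | inj₁ (s≤s y<k) rewrite search-finds k fv y y<k e h = refl

run-sound : ∀ {n} (c : Code n) t s xs y → run c t s xs ≡ suc y → Eval (snapshot s) c xs y
run-sound zer t s xs .0 refl = ev-zer
run-sound succ t s (x ∷ []) .(suc x) refl = ev-succ
run-sound (proj i) t s xs .(lookup xs i) refl = ev-proj i
run-sound orac t s (x ∷ []) .(bit s x) refl =
  subst (Eval (snapshot s) orac (x ∷ [])) (snapshot-value s x) ev-orac
run-sound (comp {m} f gs) t s xs y e with allDefined (tabulate (λ i → run (gs i) t s xs)) in defined
... | zero = ⊥-elim (0≢1+n e)
... | suc _ = ev-comp ys
    (λ i → subst (Eval (snapshot s) (gs i) xs) (sym (lookup∘tabulate _ i))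
      (run-sound (gs i) t s xs _ (nz-suc (allDefined-elim (λ i → run (gs i) t s xs)
                                            (λ e' → 1+n≢0 (trans (sym defined) e')) i))))
    (run-sound f t s ys y e)
  where
  ys : Vec ℕ m
  ys = tabulate (λ i → pred (run (gs i) t s xs))
run-sound (prec g h) t s (k ∷ xs) y e = sound-prec k y e
  where
  sound-prec : ∀ k y → run (prec g h) t s (k ∷ xs) ≡ suc y → Eval (snapshot s) (prec g h) (k ∷ xs) y
  sound-prec zero y e = ev-prec0 (run-sound g t s xs y e)
  sound-prec (suc k) y e with run (prec g h) t s (k ∷ xs) in eq
  ... | zero = ⊥-elim (0≢1+n e)
  ... | suc z = ev-precS (sound-prec k z eq) (run-sound h t s (k ∷ z ∷ xs) y e)
run-sound (mu f) t s xs y e with search t (λ k → run f t s (k ∷ xs)) in eq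
... | zero = ⊥-elim (0≢1+n e)
... | suc zero = ⊥-elim (0≢1+n e)
... | suc (suc z) with e
...   | refl with search-found t (λ k → run f t s (k ∷ xs)) z eq
...     | (e₀ , below) = ev-mu (run-sound f t s (z ∷ xs) 0 e₀)
          (λ z' p → let (w , ew) = below z' p in w , run-sound f t s (z' ∷ xs) (suc w) ew)

Eventually : (ℕ → Set) → Set
Eventually P = ∃ λ t₀ → ∀ t → t₀ ≤ t → P t

eventually-both : ∀ {P Q : ℕ → Set} → Eventually P → Eventually Q → Eventually (λ t → P t × Q t)
eventually-both (a , ha) (b , hb) =
  a ⊔ b , λ t le → ha t (≤-trans (m≤m⊔n a b) le) , hb t (≤-trans (m≤n⊔m a b) le)

eventually-mono : ∀ {P Q : ℕ → Set} → Eventually P → (∀ t → P t → Q t) → Eventually Q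
eventually-mono (t₀ , h) f = t₀ , λ t le → f t (h t le)

open Intersections Eventually eventually-mono (0 , λ _ _ → tt) eventually-both
  renaming (large-fin to eventually-fin; large-below to eventually-below)

run-complete : ∀ {s n} {c : Code n} {xs y} → Eval (snapshot s) c xs y →
  Eventually (λ t → run c t s xs ≡ suc y)
run-complete ev-zer = 0 , λ _ _ → refl
run-complete ev-succ = 0 , λ _ _ → refl
run-complete (ev-proj i) = 0 , λ _ _ → refl
run-complete {s} (ev-orac {x}) = 0 , λ _ _ → cong suc (sym (snapshot-value s x))
run-complete {s} {c = comp f gs} {xs} (ev-comp ys es ef)
  with eventually-both (eventually-fin (λ i → run-complete (es i))) (run-complete ef)
... | (T , hT) = T , λ t le → let (hg , hf) = hT t le in
  trans (ifz-nz 0 _ (allDefined-intro (λ i → run (gs i) t s xs) (λ i e → 1+n≢0 (trans (sym (hg i)) e))))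
        (trans (cong (run f t s) (trans (tabulate-cong (λ i → cong pred (hg i))) (tabulate∘lookup ys))) hf)
run-complete (ev-prec0 e) = run-complete e
run-complete {s} {c = prec g h} {suc k ∷ xs} (ev-precS ep eh)
  with eventually-both (run-complete ep) (run-complete eh)
... | (T , hT) = T , λ t le → let (h₁ , h₂) = hT t le in
  trans (cong (λ a → ifz a 0 (run h t s (k ∷ pred a ∷ xs))) h₁) h₂
run-complete {s} {c = mu f} {xs} {y} (ev-mu e₀ below)
  with eventually-both (run-complete e₀)
         (eventually-below y {P = λ z t → ∃ λ w → run f t s (z ∷ xs) ≡ suc (suc w)}
            (λ z p → let (w , ew) = below z p ; (a , ha) = run-complete ew in a , λ t le → w , ha t le))
... | (T , hT) = suc y ⊔ T , λ t le → let (h₀ , hz) = hT t (≤-trans (m≤n⊔m (suc y) T) le) in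
  cong searchResult (search-finds t (λ k → run f t s (k ∷ xs)) y (≤-trans (m≤m⊔n (suc y) T) le) h₀ hz)

-- Triples of
-- the snapshot always have m, x, l ≤ s, since their codes are below s.

justifiedAt : (ℕ → Bool) → ℕ → ℕ → ℕ → ℕ → ℕ → ℕ
justifiedAt X s L m x l =
  ifz (bit s (triple m x l)) 1 (any≤ L (λ l' → if X (triple m x l') then 1 else 0))

justified : (ℕ → Bool) → ℕ → ℕ → ℕ
justified X s L = all≤ s (λ m → all≤ s (λ x → all≤ s (λ l → justifiedAt X s L m x l)))

-- witnessK: arguments (l' ∷ m ∷ x).
witnessK : Code 3
witnessK = c1 orac (c3 tripleK (proj (suc zero)) (proj (suc (suc zero))) (proj zero))
-- justifiedAtK: arguments (l ∷ x ∷ m ∷ s ∷ L).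
justifiedAtK : Code 5
justifiedAtK = cnd
  (c2 bitK (c3 tripleK (proj (suc (suc zero))) (proj (suc zero)) (proj zero)) (proj (suc (suc (suc zero)))))
  oneK
  (c3 (anyK witnessK) (proj (suc (suc (suc (suc zero))))) (proj (suc (suc zero))) (proj (suc zero)))
-- allLK: arguments (x ∷ m ∷ s ∷ L).
allLK : Code 4
allLK = comp (allK justifiedAtK)
  (λ { zero → proj (suc (suc zero)) ; (suc zero) → proj zero ; (suc (suc zero)) → proj (suc zero)
     ; (suc (suc (suc zero))) → proj (suc (suc zero)) ; (suc (suc (suc (suc zero)))) → proj (suc (suc (suc zero))) })
-- allXLK: arguments (m ∷ s ∷ L).
allXLK : Code 3
allXLK = comp (allK allLK)
  (λ { zero → proj (suc zero) ; (suc zero) → proj zero ; (suc (suc zero)) → proj (suc zero)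
     ; (suc (suc (suc zero))) → proj (suc (suc zero)) })
-- justifiedK: arguments (s ∷ L).
justifiedK : Code 2
justifiedK = c3 (allK allXLK) (proj zero) (proj zero) (proj (suc zero))

justifiedC : ∀ {X} → Computes X justifiedK (λ { (s ∷ L ∷ []) → justified X s L })
justifiedC {X} = computes-ext (c3C (allC allXLC) (projC zero) (projC zero) (projC (suc zero)))
  (λ { (s ∷ L ∷ []) → refl })
  where
  witnessC : Computes X witnessK (λ { (l' ∷ m ∷ x ∷ []) → if X (triple m x l') then 1 else 0 })
  witnessC = computes-ext (c1C oracC (c3C tripleC (projC (suc zero)) (projC (suc (suc zero))) (projC zero)))
    (λ { (l' ∷ m ∷ x ∷ []) → refl })
  justifiedAtC : Computes X justifiedAtK (λ { (l ∷ x ∷ m ∷ s ∷ L ∷ []) → justifiedAt X s L m x l })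
  justifiedAtC = computes-ext
    (cndC (c2C bitC (c3C tripleC (projC (suc (suc zero))) (projC (suc zero)) (projC zero)) (projC (suc (suc (suc zero)))))
          oneC
          (c3C (anyC witnessC) (projC (suc (suc (suc (suc zero))))) (projC (suc (suc zero))) (projC (suc zero))))
    (λ { (l ∷ x ∷ m ∷ s ∷ L ∷ []) → refl })
  allLC : Computes X allLK (λ { (x ∷ m ∷ s ∷ L ∷ []) → all≤ s (λ l → justifiedAt X s L m x l) })
  allLC = computes-ext
    (compC {G = λ { zero → λ xs → lookup xs (suc (suc zero)) ; (suc zero) → λ xs → lookup xs zero
                  ; (suc (suc zero)) → λ xs → lookup xs (suc zero)
                  ; (suc (suc (suc zero))) → λ xs → lookup xs (suc (suc zero))
                  ; (suc (suc (suc (suc zero)))) → λ xs → lookup xs (suc (suc (suc zero))) }}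
       (allC justifiedAtC)
       (λ { zero → projC (suc (suc zero)) ; (suc zero) → projC zero ; (suc (suc zero)) → projC (suc zero)
          ; (suc (suc (suc zero))) → projC (suc (suc zero)) ; (suc (suc (suc (suc zero)))) → projC (suc (suc (suc zero))) }))
    (λ { (x ∷ m ∷ s ∷ L ∷ []) → refl })
  allXLC : Computes X allXLK (λ { (m ∷ s ∷ L ∷ []) → all≤ s (λ x → all≤ s (λ l → justifiedAt X s L m x l)) })
  allXLC = computes-ext
    (compC {G = λ { zero → λ xs → lookup xs (suc zero) ; (suc zero) → λ xs → lookup xs zero
                  ; (suc (suc zero)) → λ xs → lookup xs (suc zero)
                  ; (suc (suc (suc zero))) → λ xs → lookup xs (suc (suc zero)) }}
       (allC allLC)
       (λ { zero → projC (suc zero) ; (suc zero) → projC zero ; (suc (suc zero)) → projC (suc zero)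
          ; (suc (suc (suc zero))) → projC (suc (suc zero)) }))
    (λ { (m ∷ s ∷ L ∷ []) → refl })

Cube : ℕ → (ℕ → ℕ → ℕ → Set) → Set
Cube s R = ∀ m → m ≤ s → ∀ x → x ≤ s → ∀ l → l ≤ s → R m x l

justified-elim : ∀ X s L → justified X s L ≢ 0 → Cube s (λ m x l → justifiedAt X s L m x l ≢ 0)
justified-elim X s L j m m≤ x x≤ l l≤ =
  all≤-elim s _ (all≤-elim s _ (all≤-elim s _ j m m≤) x x≤) l l≤

justified-intro : ∀ X s L → Cube s (λ m x l → justifiedAt X s L m x l ≢ 0) → justified X s L ≢ 0
justified-intro X s L h =
  all≤-intro s _ (λ m m≤ → all≤-intro s _ (λ x x≤ → all≤-intro s _ (λ l l≤ → h m m≤ x x≤ l l≤)))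

if-true : ∀ {b} → (if b then 1 else 0) ≢ 0 → b ≡ true
if-true {true} _ = refl
if-true {false} ne = ⊥-elim (ne refl)

justifiedAt-elim : ∀ X s L m x l → bit s (triple m x l) ≢ 0 → justifiedAt X s L m x l ≢ 0 →
  ∃ λ l' → l' ≤ L × X (triple m x l') ≡ true
justifiedAt-elim X s L m x l nb j
  with any≤-elim L (λ l' → if X (triple m x l') then 1 else 0) (subst (_≢ 0) (ifz-nz 1 _ nb) j)
... | (l' , l'≤ , e) = l' , l'≤ , if-true e

justifiedAt-intro : ∀ X s L m x l →
  (bit s (triple m x l) ≢ 0 → ∃ λ l' → l' ≤ L × X (triple m x l') ≡ true) → justifiedAt X s L m x l ≢ 0
justifiedAt-intro X s L m x l h with bit s (triple m x l) in eq
... | zero = λ ()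
... | suc _ with h (λ ())
...   | (l' , l'≤ , e) =
  any≤-intro L _ l' l'≤ (subst (λ b → (if b then 1 else 0) ≢ 0) (sym e) (λ ()))

justified-partial : ∀ {C X s L} → IsPartialOracle C X → justified X s L ≢ 0 →
  IsPartialOracle C (snapshot s)
justified-partial {C} {X} {s} {L} po j n x l e
  with justifiedAt-elim X s L n x l nb
         (justified-elim X s L j n (bounded (triple≥₁ n x l)) x (bounded (triple≥₂ n x l))
                                   l (bounded (triple≥₃ n x l)))
  where
  nb : bit s (triple n x l) ≢ 0
  nb = isNZ⇒≢0 e
  bounded : ∀ {a} → a ≤ triple n x l → a ≤ s
  bounded a≤ = ≤-trans a≤ (<⇒≤ (bit-bound s (triple n x l) nb))
... | (l' , _ , e') = po n x l' e'

justified-sub : ∀ X s → (∀ q → bit s q ≢ 0 → X q ≡ true) → ∀ L → s ≤ L → justified X s L ≢ 0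
justified-sub X s h L s≤L = justified-intro X s L λ m _ x _ l l≤ →
  justifiedAt-intro X s L m x l (λ nb → l , ≤-trans l≤ s≤L , h _ nb)

eventually-≤ : ∀ s {P : ℕ → ℕ → Set} → (∀ z → z ≤ s → Eventually (P z)) →
  Eventually (λ t → ∀ z → z ≤ s → P z t)
eventually-≤ s h with eventually-below (suc s) (λ z z< → h z (≤-pred z<))
... | (T , hT) = T , λ t le z z≤ → hT t le z (s≤s z≤)

eventually-cube : ∀ s {R : ℕ → ℕ → ℕ → ℕ → Set} → Cube s (λ m x l → Eventually (R m x l)) →
  Eventually (λ t → Cube s (λ m x l → R m x l t))
eventually-cube s {R} h =
  eventually-≤ s {λ m t → ∀ x → x ≤ s → ∀ l → l ≤ s → R m x l t} λ m m≤ →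
    eventually-≤ s {λ x t → ∀ l → l ≤ s → R m x l t} λ x x≤ →
      eventually-≤ s {R m x} (h m m≤ x x≤)

justified-transfer : ∀ O₀ O₁ s L → OracleExtends O₀ O₁ → justified O₀ s L ≢ 0 →
  Eventually (λ L' → justified O₁ s L' ≢ 0)
justified-transfer O₀ O₁ s L (_ , agree) j =
  let (T , hT) = eventually-cube s {λ m x l L' → justifiedAt O₁ s L' m x l ≢ 0} each
  in T , λ L' le → justified-intro O₁ s L' (hT L' le)
  where
  each : Cube s (λ m x l → Eventually (λ L' → justifiedAt O₁ s L' m x l ≢ 0))
  each m m≤ x x≤ l l≤ with bit s (triple m x l) ≟ 0
  ... | yes eq = 0 , λ L' _ → justifiedAt-intro O₁ s L' m x l (λ nb → ⊥-elim (nb eq))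
  ... | no nb with justifiedAt-elim O₀ s L m x l nb (justified-elim O₀ s L j m m≤ x x≤ l l≤)
  ...   | (l' , _ , e₀) with proj₂ (agree m (x , l' , e₀) x) (l' , e₀)
  ...     | (l'' , e₁) = l'' , λ L' le → justifiedAt-intro O₁ s L' m x l (λ _ → l'' , le , e₁)

least-zero : ∀ (F : ℕ → ℕ) w → F w ≡ 0 → ∃ λ y → F y ≡ 0 × (∀ z → z < y → F z ≢ 0)
least-zero F w e = from w 0 e (λ _ ())
  where
  from : ∀ d z → F (z + d) ≡ 0 → (∀ z' → z' < z → F z' ≢ 0) → ∃ λ y → F y ≡ 0 × (∀ z → z < y → F z ≢ 0)
  from d z e below with F z ≟ 0
  ... | yes e₀ = z , e₀ , below
  from zero z e below | no nz = ⊥-elim (nz (subst (λ v → F v ≡ 0) (+-identityʳ z) e))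
  from (suc d) z e below | no nz = from d (suc z) (subst (λ v → F v ≡ 0) (+-suc z d) e) below'
    where
    below' : ∀ z' → z' < suc z → F z' ≢ 0
    below' z' z'< with m≤n⇒m<n∨m≡n z'<
    ... | inj₂ refl = nz
    ... | inj₁ (s≤s z'<z) = below z' z'<z

mu-halts : ∀ {X m} {c : Code (suc m)} {F : Vec ℕ (suc m) → ℕ} → Computes X c F →
  ∀ xs w → F (w ∷ xs) ≡ 0 → ∃ λ y → Eval X (mu c) xs y
mu-halts {X} {c = c} {F} cf xs w e with least-zero (λ z → F (z ∷ xs)) w e
... | (y , e₀ , below) = y , ev-mu (subst (Eval X c (y ∷ xs)) e₀ (cf _))
  (λ z z<y → pred (F (z ∷ xs)) , subst (Eval X c (z ∷ xs)) (nz-suc (below z z<y)) (cf _))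

density1-mono : ∀ {P R : ℕ → Set} → Density1 P → (∀ n → P n → R n) → Density1 R
density1-mono d f k with d k
... | (N , h) = N , λ n le → let (xs , u , al , bound) = h n le in
  xs , u , All.map (λ { (a , b) → a , f _ b }) al , bound

density1-all : ∀ {P : ℕ → Set} → (∀ n → P n) → Density1 P
density1-all f k = 0 , λ n _ → upTo n , upTo⁺ n , All.map (λ lt → lt , f _) (all-upTo n) ,
  subst (λ v → suc k * (n ∸ v) ≤ n) (sym (length-upTo n))
    (subst (λ v → suc k * v ≤ n) (sym (n∸n≡0 n)) (subst (_≤ n) (sym (*-zeroʳ k)) z≤n))

eqN : ℕ → ℕ → ℕ
eqN a b with a ≟ b
... | yes _ = 1
... | no _ = 0

eqN-elim : ∀ a b → eqN a b ≢ 0 → a ≡ b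
eqN-elim a b ne with a ≟ b
... | yes p = p
... | no _ = ⊥-elim (ne refl)

eqN-refl : ∀ a → eqN a a ≢ 0
eqN-refl a with a ≟ a
... | yes _ = λ ()
... | no np = ⊥-elim (np refl)

∈⇒≤sum : ∀ {q Q} → q ∈ Q → q ≤ sum Q
∈⇒≤sum (here refl) = m≤m+n _ _
∈⇒≤sum {Q = x ∷ Q} (there m) = ≤-trans (∈⇒≤sum m) (m≤n+m _ x)

fullOracle : Real → ℕ → Bool
fullOracle C q = isNZ (any≤ q (λ m → any≤ q (λ l → eqN q (triple m (b2n (C m)) l))))

fullOracle-elim : ∀ C q → fullOracle C q ≡ true → ∃ λ m → ∃ λ l → q ≡ triple m (b2n (C m)) l
fullOracle-elim C q e
  with any≤-elim q (λ m → any≤ q (λ l → eqN q (triple m (b2n (C m)) l))) (isNZ⇒≢0 e)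
... | (m , _ , e₁) with any≤-elim q (λ l → eqN q (triple m (b2n (C m)) l)) e₁
...   | (l , _ , e₂) = m , l , eqN-elim q (triple m (b2n (C m)) l) e₂

fullOracle-intro : ∀ C m l → fullOracle C (triple m (b2n (C m)) l) ≡ true
fullOracle-intro C m l = ≢0⇒isNZ
  (any≤-intro q (λ m → any≤ q (λ l → eqN q (triple m (b2n (C m)) l))) m (triple≥₁ m (b2n (C m)) l)
    (any≤-intro q (λ l → eqN q (triple m (b2n (C m)) l)) l (triple≥₃ m (b2n (C m)) l) (eqN-refl q)))
  where
  q : ℕ
  q = triple m (b2n (C m)) l

patch : Real → List ℕ → (ℕ → Bool) → ℕ → Bool
patch C Q P q with q ∈? Q
... | yes _ = P q
... | no _ = fullOracle C q

patch-agree : ∀ C Q P → Agree Q P (patch C Q P)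
patch-agree C Q P q q∈Q with q ∈? Q
... | yes _ = refl
... | no q∉Q = ⊥-elim (q∉Q q∈Q)

b2n-case : ∀ {x} b → x ≡ b2n b → (x ≡ 0 × b ≡ false) ⊎ (x ≡ 1 × b ≡ true)
b2n-case true e = inj₂ (e , refl)
b2n-case false e = inj₁ (e , refl)

patch-partial : ∀ C Q P → IsPartialOracle C P → IsPartialOracle C (patch C Q P)
patch-partial C Q P po n x l e with triple n x l ∈? Q
... | yes _ = po n x l e
... | no _ = from-full (fullOracle-elim C (triple n x l) e)
  where
  correct : ∀ {m} → n ≡ m × x ≡ b2n (C m) → (x ≡ 0 × C n ≡ false) ⊎ (x ≡ 1 × C n ≡ true)
  correct (refl , refl) = b2n-case (C n) refl
  from-full : (∃ λ m → ∃ λ l' → triple n x l ≡ triple m (b2n (C m)) l') →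
    (x ≡ 0 × C n ≡ false) ⊎ (x ≡ 1 × C n ≡ true)
  from-full (m , l' , e') = correct (triple-injective {n} {x} {l} {m} {b2n (C m)} {l'} e')

-- Every n is in the domain of the patch: with l beyond Q, ⟨n, C(n), l⟩ lies
-- outside Q and is a yes of the full oracle.
patch-total : ∀ C Q P n → dom (patch C Q P) n
patch-total C Q P n = b2n (C n) , l , yes-at-q
  where
  l q : ℕ
  l = suc (sum Q)
  q = triple n (b2n (C n)) l
  q∉Q : q ∉ Q
  q∉Q q∈Q = <⇒≱ (≤-trans (s≤s ≤-refl) (triple≥₃ n (b2n (C n)) l)) (∈⇒≤sum q∈Q)
  yes-at-q : patch C Q P q ≡ true
  yes-at-q with q ∈? Q
  ... | yes q∈Q = ⊥-elim (q∉Q q∈Q)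
  ... | no _ = fullOracle-intro C n l

-- If D generically reduces to C via χ, then every halting computation of χ
-- on any partial oracle P for C has the correct value: by finite use it is
-- also a computation on a patch of P, which is a generic oracle for C.
reduction-correct : ∀ {D C χ} → GenRedVia D C χ → ∀ {P} → IsPartialOracle C P →
  ∀ {n y} → χ ^ P ⟨ n ⟩≡ y → (y ≡ 0 × D n ≡ false) ⊎ (y ≡ 1 × D n ≡ true)
reduction-correct {D} {C} red {P} po {n} {y} ev with finite-use ev
... | (Q , h) = proj₂ (red G (patch-partial C Q P po , density1-all (patch-total C Q P))) n y
                      (h G (patch-agree C Q P))
  where
  G : ℕ → Bool
  G = patch C Q P

module Monotonisation (φ : Functional) where

  good : (ℕ → Bool) → ℕ → ℕ → ℕ → ℕ
  good X s w n = ifz (run φ w s (n ∷ [])) 0 (justified X s w)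

  good-elim : ∀ X s w n → good X s w n ≢ 0 →
    ∃ λ y → run φ w s (n ∷ []) ≡ suc y × justified X s w ≢ 0
  good-elim X s w n g with run φ w s (n ∷ [])
  ... | zero = ⊥-elim (g refl)
  ... | suc y = y , refl , g

  good-intro : ∀ X s w n y → run φ w s (n ∷ []) ≡ suc y → justified X s w ≢ 0 → good X s w n ≢ 0
  good-intro X s w n y e j rewrite e = j

  candidate : (ℕ → Bool) → ℕ → ℕ → ℕ → ℕ
  candidate X zero w n = 0
  candidate X (suc k) w n = ifz (good X (candidate X k w n) w n) (suc k) (candidate X k w n)

  -- The codes are opaque: later reasoning only uses their specifications.
  opaque
    goodK : Code 3
    goodK = cnd (c3 (runK φ) (proj (suc zero)) (proj zero) (proj (suc (suc zero)))) zer
                (c2 justifiedK (proj zero) (proj (suc zero)))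
    goodC : ∀ {X} → Computes X goodK (λ { (s ∷ w ∷ n ∷ []) → good X s w n })
    goodC = computes-ext
      (cndC (c3C (runC φ) (projC (suc zero)) (projC zero) (projC (suc (suc zero)))) zerC
            (c2C justifiedC (projC zero) (projC (suc zero))))
      (λ { (s ∷ w ∷ n ∷ []) → refl })

    candidateK : Code 3
    candidateK = prec zer
      (cnd (c3 goodK (proj (suc zero)) (proj (suc (suc zero))) (proj (suc (suc (suc zero)))))
           (c1 succ (proj zero)) (proj (suc zero)))
    candidateC : ∀ {X} → Computes X candidateK (λ { (k ∷ w ∷ n ∷ []) → candidate X k w n })
    candidateC = precC zerC
      (cndC (c3C goodC (projC (suc zero)) (projC (suc (suc zero))) (projC (suc (suc (suc zero)))))
            (c1C succC (projC zero)) (projC (suc zero)))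
      (λ { (w ∷ n ∷ []) → refl }) (λ { k (w ∷ n ∷ []) → refl })

    stageK : Code 2
    stageK = c3 candidateK (proj zero) (proj zero) (proj (suc zero))
    stageC : ∀ {X} → Computes X stageK (λ { (w ∷ n ∷ []) → candidate X w w n })
    stageC = computes-ext (c3C candidateC (projC zero) (projC zero) (projC (suc zero)))
      (λ { (w ∷ n ∷ []) → refl })

    checkK : Code 2
    checkK = cnd (c3 goodK stageK (proj zero) (proj (suc zero))) oneK zer
    checkC : ∀ {X} → Computes X checkK (λ { (w ∷ n ∷ []) → ifz (good X (candidate X w w n) w n) 1 0 })
    checkC = computes-ext (cndC (c3C goodC stageC (projC zero) (projC (suc zero))) oneC zerC)
      (λ { (w ∷ n ∷ []) → refl })

    outputK : Code 2
    outputK = c1 predK (c3 (runK φ) (proj zero) stageK (proj (suc zero)))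
    outputC : ∀ {X} → Computes X outputK (λ { (w ∷ n ∷ []) → pred (run φ w (candidate X w w n) (n ∷ [])) })
    outputC = computes-ext (c1C predC (c3C (runC φ) (projC zero) stageC (projC (suc zero))))
      (λ { (w ∷ n ∷ []) → refl })

  ψ : Functional
  ψ = c2 outputK (mu checkK) (proj zero)

  candidate-good : ∀ X k w n s → s ≤ k → good X s w n ≢ 0 → good X (candidate X k w n) w n ≢ 0
  candidate-good X zero w n .0 z≤n g = g
  candidate-good X (suc k) w n s s≤ g with good X (candidate X k w n) w n in eq
  ... | suc _ = λ e → 1+n≢0 (trans (sym eq) e)
  ... | zero with m≤n⇒m<n∨m≡n s≤
  ...   | inj₂ refl = g
  ...   | inj₁ (s≤s s≤k) = ⊥-elim (candidate-good X k w n s s≤k g eq)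

  ψ-halts : ∀ X n w s → s ≤ w → good X s w n ≢ 0 → domF ψ X n
  ψ-halts X n w s s≤w g
    with mu-halts checkC (n ∷ []) w (ifz-good (candidate-good X w w n s s≤w g))
    where
    ifz-good : ∀ {a} → a ≢ 0 → ifz a 1 0 ≡ 0
    ifz-good {zero} ne = ⊥-elim (ne refl)
    ifz-good {suc a} ne = refl
  ... | (w' , ev) = _ , ev-comp (w' ∷ n ∷ []) (λ { zero → ev ; (suc zero) → ev-proj zero }) (outputC _)

  ψ-inversion : ∀ {X n y} → ψ ^ X ⟨ n ⟩≡ y →
    ∃ λ w → good X (candidate X w w n) w n ≢ 0 × y ≡ pred (run φ w (candidate X w w n) (n ∷ []))
  ψ-inversion {X} {n} (ev-comp (w ∷ m ∷ []) es eo) with es zero | es (suc zero)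
  ... | ev-mu e₀ _ | ev-proj .zero =
    w , good-of (det e₀ (checkC (w ∷ n ∷ []))) , det eo (outputC (w ∷ n ∷ []))
    where
    good-of : ∀ {a} → 0 ≡ ifz a 1 0 → a ≢ 0
    good-of {zero} () _
    good-of {suc a} _ ()

  ψ-sound : ∀ {X n y} → ψ ^ X ⟨ n ⟩≡ y →
    ∃ λ s → ∃ λ w → justified X s w ≢ 0 × φ ^ snapshot s ⟨ n ⟩≡ y
  ψ-sound {X} {n} ev with ψ-inversion ev
  ... | (w , g , y≡) with good-elim X (candidate X w w n) w n g
  ...   | (y' , e , j) = candidate X w w n , w , j ,
    subst (φ ^ snapshot (candidate X w w n) ⟨ n ⟩≡_) (sym (trans y≡ (cong pred e)))
          (run-sound φ w (candidate X w w n) (n ∷ []) y' e)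

  ψ-halts-on : ∀ X n s {y} → φ ^ snapshot s ⟨ n ⟩≡ y → Eventually (λ L → justified X s L ≢ 0) →
    domF ψ X n
  ψ-halts-on X n s {y} ev (T , hT) with run-complete ev
  ... | (t₀ , ht) = ψ-halts X n w s s≤w (good-intro X s w n y (ht w (m≤m⊔n t₀ _)) (hT w T≤w))
    where
    w : ℕ
    w = t₀ ⊔ (T ⊔ s)
    s≤w : s ≤ w
    s≤w = ≤-trans (m≤n⊔m T s) (m≤n⊔m t₀ (T ⊔ s))
    T≤w : T ≤ w
    T≤w = ≤-trans (m≤m⊔n T s) (m≤n⊔m t₀ (T ⊔ s))

  -- ψ^X halts wherever φ^X does: use the snapshot of X below the use of φ^X(n).
  ψ-dom : ∀ X n → domF φ X n → domF ψ X n
  ψ-dom X n (y , ev) with finite-use ev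
  ... | (Q , h) = ψ-halts-on X n s (h (snapshot s) (λ q q∈Q → encode-agree N X q (s≤s (∈⇒≤sum q∈Q))))
                    (s , justified-sub X s (encode-sub N X))
    where
    N s : ℕ
    N = suc (sum Q)
    s = encode N X

  ψ-dom-extends : ∀ O₀ O₁ → OracleExtends O₀ O₁ → ∀ n → domF ψ O₀ n → domF ψ O₁ n
  ψ-dom-extends O₀ O₁ ext n (_ , ev) with ψ-sound ev
  ... | (s , w , j , evφ) = ψ-halts-on O₁ n s evφ (justified-transfer O₀ O₁ s w ext j)

monotone : Functional → Functional
monotone = Monotonisation.ψ

monotone-reduces : ∀ {A B} φ → GenRedVia A B φ → GenRedVia A B (monotone φ)
monotone-reduces {A} φ red O (po , dense) =
  density1-mono (proj₁ (red O (po , dense))) (ψ-dom O) , correct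
  where
  open Monotonisation φ
  correct : ∀ n y → ψ ^ O ⟨ n ⟩≡ y → (y ≡ 0 × A n ≡ false) ⊎ (y ≡ 1 × A n ≡ true)
  correct n y ev with ψ-sound ev
  ... | (s , w , j , evφ) = reduction-correct red (justified-partial {X = O} {L = w} po j) evφ

same-value : ∀ {y y' : ℕ} {d : Bool} → (y ≡ 0 × d ≡ false) ⊎ (y ≡ 1 × d ≡ true) →
  (y' ≡ 0 × d ≡ false) ⊎ (y' ≡ 1 × d ≡ true) → y ≡ y'
same-value (inj₁ (refl , _)) (inj₁ (refl , _)) = refl
same-value (inj₂ (refl , _)) (inj₂ (refl , _)) = refl
same-value (inj₁ (_ , refl)) (inj₂ (_ , ()))
same-value (inj₂ (_ , refl)) (inj₁ (_ , ()))

-- The monotonisation is monotone on partial oracles for any real C that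
-- some real reduces to via it: domains grow by ψ-dom-extends, and values on
-- either oracle are the correct values of D, hence equal.
monotone-extends : ∀ φ (C : Real) → (∃ λ (D : Real) → GenRedVia D C (monotone φ)) →
  ∀ (O₀ O₁ : ℕ → Bool) → IsPartialOracle C O₀ → IsPartialOracle C O₁ →
  OracleExtends O₀ O₁ → FunctionalExtends (monotone φ) O₀ O₁
monotone-extends φ C (D , red) O₀ O₁ po₀ po₁ ext = ψ-dom-extends O₀ O₁ ext , values
  where
  open Monotonisation φ
  values : ∀ n → domF ψ O₀ n → ∀ y → (ψ ^ O₁ ⟨ n ⟩≡ y → ψ ^ O₀ ⟨ n ⟩≡ y) × (ψ ^ O₀ ⟨ n ⟩≡ y → ψ ^ O₁ ⟨ n ⟩≡ y)
  values n (y₀ , ev₀) y =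
    (λ ev₁ → subst (ψ ^ O₀ ⟨ n ⟩≡_) (same-value (reduction-correct red po₀ ev₀) (reduction-correct red po₁ ev₁)) ev₀) ,
    (λ ev₀' → let (y₁ , ev₁) = ψ-dom-extends O₀ O₁ ext n (y₀ , ev₀) in
       subst (ψ ^ O₁ ⟨ n ⟩≡_) (same-value (reduction-correct red po₁ ev₁) (reduction-correct red po₀ ev₀')) ev₁)

mainTheorem18 : (A B : Real) →
    (B ≥g A) ⇔
    (∃ λ (φ : Functional) →
       GenRedVia A B φ ×
       (∀ (C : Real) → (∃ λ (D : Real) → GenRedVia D C φ) →
          ∀ (O₀ O₁ : ℕ → Bool) → IsPartialOracle C O₀ → IsPartialOracle C O₁ →
          OracleExtends O₀ O₁ → FunctionalExtends φ O₀ O₁))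
mainTheorem18 A B = mk⇔
  (λ (φ , red) → monotone φ , monotone-reduces φ red , monotone-extends φ)
  (λ (φ , red , _) → φ , red)
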